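{- Let $G$ be a nontrivial connected graph with maximum degree $\Delta(G)\le 2$. Then there exists a $\gamma_{tR2}(G)$-function $f=(V_0,V_1,V_2)$ with $V_2=\emptyset$.
   Context: All graphs are finite and simple. For $f:V(G)\to\{0,1,2\}$ let $V_i=\{v:f(v)=i\}$ and write $f=(V_0,V_1,V_2)$; $f$ is a total Roman $\{2\}$-dominating function (TR2DF) if every vertex $v$ with $f(v)=0$ has a neighbor $u$ with $f(u)=2$ or two distinct neighbors $x,y$ with $f(x)=f(y)=1$, and the subgraph induced by $V_1\cup V_2$ has no isolated vertices. $\gamma_{tR2}(G)$ is the minimum weight $\sum_v f(v)$ of a TR2DF of $G$, and a TR2DF of weight $\gamma_{tR2}(G)$ is a $\gamma_{tR2}(G)$-function. -}

module Defs where

open import Data.Nat using (ℕ; _≤_; _+_)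
open import Data.Fin using (Fin; toℕ; zero; suc)
open import Data.Bool using (Bool; T; true; false)
open import Data.List using (List; length; filter; map; allFin)
open import Data.Nat.ListAction using (sum)
open import Data.Product using (Σ; _×_; ∃; ∃-syntax; _,_)
open import Data.Sum using (_⊎_)
open import Relation.Nullary using (¬_)
open import Relation.Binary.PropositionalEquality using (_≡_; _≢_)
open import Relation.Nullary.Decidable using (T?)

record Graph (n : ℕ) : Set where
  field
    adj    : Fin n → Fin n → Bool
    sym    : ∀ u v → adj u v ≡ adj v u
    irrefl : ∀ v → adj v v ≡ false

open Graph public

Adj : ∀ {n} → Graph n → Fin n → Fin n → Set
Adj G u v = T (adj G u v)

degree : ∀ {n} → Graph n → Fin n → ℕ
degree {n} G v = length (filter (λ u → T? (adj G v u)) (allFin n))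

MaxDegree≤ : ∀ {n} → Graph n → ℕ → Set
MaxDegree≤ G k = ∀ v → degree G v ≤ k

data Reachable {n} (G : Graph n) : Fin n → Fin n → Set where
  here : ∀ {v} → Reachable G v v
  step : ∀ {u w v} → Adj G u w → Reachable G w v → Reachable G u v

Connected : ∀ {n} → Graph n → Set
Connected {n} G = ∀ (u v : Fin n) → Reachable G u v

Nontrivial : ∀ {n} → Graph n → Set
Nontrivial {n} _ = 2 ≤ n

Labeling : ℕ → Set
Labeling n = Fin n → Fin 3

l0 l1 l2 : Fin 3
l0 = zero
l1 = suc zero
l2 = suc (suc zero)

weight : ∀ {n} → Labeling n → ℕ
weight {n} f = sum (map (λ v → toℕ (f v)) (allFin n))

IsTR2DF : ∀ {n} → Graph n → Labeling n → Set
IsTR2DF {n} G f =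
  (∀ v → f v ≡ l0 →
     (∃[ u ] (Adj G v u × f u ≡ l2))
     ⊎ (∃[ x ] ∃[ y ] (x ≢ y × Adj G v x × Adj G v y × f x ≡ l1 × f y ≡ l1)))
  ×
  -- totality: G[V1 ∪ V2] has no isolated vertices
  (∀ v → f v ≢ l0 → ∃[ u ] (Adj G v u × f u ≢ l0))

IsGammaTR2Function : ∀ {n} → Graph n → Labeling n → Set
IsGammaTR2Function G f = IsTR2DF G f × (∀ g → IsTR2DF G g → weight f ≤ weight g)

{-# OPTIONS --safe #-}
module Submission where

-- Let f be a TR2DF with f(v) = 2. By totality v has a neighbour u with f(u) ≠ 0, so, as Δ ≤ 2,
-- v has at most one neighbour w with f(w) = 0. Relabelling v and w (if present) by 1 gives a
-- TR2DF of no larger weight with one 2 fewer: the only vertex that could have relied on the 2 at v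
-- is w. Iterating this from a γ_tR2-function, which exists because there are finitely many
-- labelings and the all-ones labeling is a TR2DF of a connected nontrivial graph, removes every 2.

open import Defs hiding (sym)
open import Data.Nat using (ℕ; zero; suc; _+_; _≤_; _<_; z≤n; s≤s; _≤?_)
open import Data.Nat.Properties
  using (≤-refl; ≤-trans; ≤-reflexive; <⇒≤; ≰⇒>; ≮⇒≥; suc-injective;
         +-0-commutativeMonoid; +-commutativeSemigroup)
open import Data.Nat.Induction using (<-wellFounded)
open import Data.Nat.ListAction using (sum)
open import Algebra.Properties.CommutativeMonoid.Sum +-0-commutativeMonoid
  using (sum-remove; sum-cong-≗) renaming (sum to ∑)
open import Algebra.Properties.CommutativeSemigroup +-commutativeSemigroup using (x∙yz≈y∙xz)
open import Data.Fin using (Fin; zero; suc; toℕ; punchIn)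
open import Data.Fin.Properties using (_≟_; any?; all?; pigeonhole; punchInᵢ≢i; <⇒≢)
open import Data.Vec.Functional using (Vector; []; _∷_; head; tail; updateAt; removeAt)
open import Data.Vec.Functional.Properties using (updateAt-updates; updateAt-minimal; ∷-cong)
open import Data.List using (List; length; lookup; tabulate; allFin)
open import Data.List.Properties using (map-tabulate; map-cong)
open import Data.List.Membership.Propositional using (_∈_)
open import Data.List.Membership.Propositional.Properties using (∈-filter⁺; ∈-allFin)
open import Data.List.Relation.Unary.Any using (index)
open import Data.List.Relation.Unary.Any.Properties using (lookup-index)
open import Data.Bool using (T)
open import Data.Product using (∃; ∃-syntax; _×_; _,_; proj₂)
open import Data.Sum using (_⊎_; inj₁; inj₂)
open import Function using (_∘_; id; const)
open import Function.Definitions using (Injective)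
open import Induction.WellFounded using (Acc; acc)
open import Relation.Nullary using (Dec; yes; no; contradiction)
open import Relation.Nullary.Decidable using (T?; map′; _×-dec_; _⊎-dec_; _→-dec_; ¬?)
open import Relation.Unary using (Pred; Decidable)
open import Relation.Binary.PropositionalEquality
  using (_≡_; _≢_; _≗_; refl; sym; trans; cong; subst; subst₂; module ≡-Reasoning)

private
  variable
    m n : ℕ
    G : Graph n
    f g : Labeling n
    u v w : Fin n

∑-update : (h h′ : Vector ℕ n) (v : Fin n) → (∀ x → x ≢ v → h′ x ≡ h x) →
           h v + ∑ h′ ≡ h′ v + ∑ h
∑-update {suc n} h h′ v agree = begin
  h v + ∑ h′                       ≡⟨ cong (h v +_) (sum-remove {i = v} h′) ⟩
  h v + (h′ v + ∑ (removeAt h′ v)) ≡⟨ cong (λ s → h v + (h′ v + s)) (sum-cong-≗ away-from-v) ⟩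
  h v + (h′ v + ∑ (removeAt h v))  ≡⟨ x∙yz≈y∙xz (h v) (h′ v) _ ⟩
  h′ v + (h v + ∑ (removeAt h v))  ≡⟨ cong (h′ v +_) (sym (sum-remove h)) ⟩
  h′ v + ∑ h                       ∎
  where
  open ≡-Reasoning
  away-from-v : removeAt h′ v ≗ removeAt h v
  away-from-v j = agree (punchIn v j) (punchInᵢ≢i v j)

sum-tabulate : (h : Vector ℕ n) → sum (tabulate h) ≡ ∑ h
sum-tabulate {zero}  h = refl
sum-tabulate {suc n} h = cong (h zero +_) (sum-tabulate (h ∘ suc))

infixl 6 _[_]≔_

_[_]≔_ : ∀ {a} {A : Set a} → Vector A n → Fin n → A → Vector A n
f [ v ]≔ a = updateAt f v (const a)

∑-[]≔ : ∀ {a} {A : Set a} (φ : A → ℕ) (f : Vector A n) (v : Fin n) (x : A) →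
        φ (f v) + ∑ (φ ∘ (f [ v ]≔ x)) ≡ φ x + ∑ (φ ∘ f)
∑-[]≔ φ f v x =
  trans (∑-update (φ ∘ f) (φ ∘ (f [ v ]≔ x)) v (λ y y≢v → cong φ (updateAt-minimal y v f y≢v)))
        (cong (λ a → φ a + ∑ (φ ∘ f)) (updateAt-updates v f))

distinct₃-injective : ∀ {a} {A : Set a} {x y z : A} → x ≢ y → x ≢ z → y ≢ z →
  Injective _≡_ _≡_ (x ∷ y ∷ z ∷ [])
distinct₃-injective _   _   _   {zero}           {zero}           _ = refl
distinct₃-injective x≢y _   _   {zero}           {suc zero}       e = contradiction e x≢y
distinct₃-injective _   x≢z _   {zero}           {suc (suc zero)} e = contradiction e x≢z
distinct₃-injective x≢y _   _   {suc zero}       {zero}           e = contradiction (sym e) x≢y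
distinct₃-injective _   _   _   {suc zero}       {suc zero}       _ = refl
distinct₃-injective _   _   y≢z {suc zero}       {suc (suc zero)} e = contradiction e y≢z
distinct₃-injective _   x≢z _   {suc (suc zero)} {zero}           e = contradiction (sym e) x≢z
distinct₃-injective _   _   y≢z {suc (suc zero)} {suc zero}       e = contradiction (sym e) y≢z
distinct₃-injective _   _   _   {suc (suc zero)} {suc (suc zero)} _ = refl

injective-members⇒≤length : ∀ {a} {A : Set a} {xs : List A} (x : Fin m → A) →
  Injective _≡_ _≡_ x → (∀ i → x i ∈ xs) → m ≤ length xs
injective-members⇒≤length {xs = xs} x x-inj x∈xs = ≮⇒≥ λ length<m →
  let i , j , i<j , same-index = pigeonhole length<m (index ∘ x∈xs)
  in <⇒≢ i<j (x-inj (begin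
       x i                        ≡⟨ lookup-index (x∈xs i) ⟩
       lookup xs (index (x∈xs i)) ≡⟨ cong (lookup xs) same-index ⟩
       lookup xs (index (x∈xs j)) ≡⟨ lookup-index (x∈xs j) ⟨
       x j                        ∎))
  where open ≡-Reasoning

anyVector? : ∀ {p} n {P : Pred (Vector (Fin m) n) p} →
  (∀ {f g} → f ≗ g → P f → P g) → Decidable P → Dec (∃ P)
anyVector? zero    resp P? = map′ ([] ,_) (λ (f , pf) → resp (λ ()) pf) (P? [])
anyVector? (suc n) resp P? =
  map′ (λ (a , f , pf) → a ∷ f , pf)
       (λ (f , pf) → head f , tail f , resp (∷-cong refl λ _ → refl) pf)
       (any? λ a → anyVector? n (resp ∘ ∷-cong refl) (P? ∘ (a ∷_)))

module _ {a p} {A : Set a} {P : Pred A p} (μ : A → ℕ)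
         (bounded? : ∀ k → Dec (∃ λ x → P x × μ x ≤ k)) where

  ∃-minimal : ∀ {x} → P x → ∃ λ y → P y × (∀ z → P z → μ y ≤ μ z)
  ∃-minimal {x} px = descend (μ x) px ≤-refl
    where
    descend : ∀ k {x} → P x → μ x ≤ k → ∃ λ y → P y × (∀ z → P z → μ y ≤ μ z)
    descend zero    px μx≤0 = _ , px , λ _ _ → ≤-trans μx≤0 z≤n
    descend (suc k) px μx≤1+k with bounded? k
    ... | yes (y , py , μy≤k) = descend k py μy≤k
    ... | no  none            = _ , px , λ z pz → ≤-trans μx≤1+k (≰⇒> λ μz≤k → none (z , pz , μz≤k))

Adj-sym : (G : Graph n) → Adj G u v → Adj G v u
Adj-sym {u = u} {v} G = subst T (Graph.sym G u v)

Adj-irrefl : (G : Graph n) → Adj G u v → u ≢ v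
Adj-irrefl {u = u} G u~u refl = subst T (irrefl G u) u~u

reachable-≢⇒neighbour : (G : Graph n) → Reachable G u w → u ≢ w → ∃[ x ] Adj G u x
reachable-≢⇒neighbour G here       u≢u = contradiction refl u≢u
reachable-≢⇒neighbour G (step u~x _) _ = _ , u~x

connected⇒neighbour : (G : Graph n) → Nontrivial G → Connected G → ∀ v → ∃[ u ] Adj G v u
connected⇒neighbour G (s≤s (s≤s z≤n)) connected v =
  reachable-≢⇒neighbour G (connected v (punchIn v zero)) (punchInᵢ≢i v zero ∘ sym)

injective-neighbours⇒≤degree : (G : Graph n) (x : Fin m → Fin n) →
  Injective _≡_ _≡_ x → (∀ i → Adj G v (x i)) → m ≤ degree G v
injective-neighbours⇒≤degree {v = v} G x x-inj v~x =
  injective-members⇒≤length x x-inj λ i →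
    ∈-filter⁺ (λ u → T? (adj G v u)) (∈-allFin (x i)) (v~x i)

maxDegree≤2-neighbours : (G : Graph n) → MaxDegree≤ G 2 →
  Adj G v u → Adj G v w → u ≢ w → ∀ {z} → Adj G v z → z ≡ u ⊎ z ≡ w
maxDegree≤2-neighbours {v = v} {u} {w} G Δ≤2 v~u v~w u≢w {z} v~z with z ≟ u | z ≟ w
... | yes z≡u | _        = inj₁ z≡u
... | no  _   | yes z≡w  = inj₂ z≡w
... | no  z≢u | no  z≢w  = contradiction (≤-trans three≤degree (Δ≤2 v)) λ { (s≤s (s≤s ())) }
  where
  three≤degree : 3 ≤ degree G v
  three≤degree = injective-neighbours⇒≤degree G (u ∷ w ∷ z ∷ [])
    (distinct₃-injective u≢w (z≢u ∘ sym) (z≢w ∘ sym))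
    λ { zero → v~u ; (suc zero) → v~w ; (suc (suc zero)) → v~z }

weight≡∑ : (f : Labeling n) → weight f ≡ ∑ (toℕ ∘ f)
weight≡∑ f = trans (cong sum (map-tabulate id (toℕ ∘ f))) (sum-tabulate (toℕ ∘ f))

weight-cong : f ≗ g → weight f ≡ weight g
weight-cong {n} f≗g = cong sum (map-cong (cong toℕ ∘ f≗g) (allFin n))

weight-[]≔ : (f : Labeling n) (v : Fin n) (x : Fin 3) →
             toℕ (f v) + weight (f [ v ]≔ x) ≡ toℕ x + weight f
weight-[]≔ f v x =
  subst₂ (λ p q → toℕ (f v) + p ≡ toℕ x + q) (sym (weight≡∑ (f [ v ]≔ x))) (sym (weight≡∑ f))
         (∑-[]≔ toℕ f v x)

isTwo : Fin 3 → ℕ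
isTwo (suc (suc zero)) = 1
isTwo _                = 0

twos : Labeling n → ℕ
twos f = ∑ (isTwo ∘ f)

module _ (f : Labeling n) (v : Fin n) where

  private
    f′ : Labeling n
    f′ = f [ v ]≔ l1

  lower-weight : f v ≡ l2 → suc (weight f′) ≡ weight f
  lower-weight fv =
    suc-injective (subst (λ a → toℕ a + weight f′ ≡ 1 + weight f) fv (weight-[]≔ f v l1))

  lower-twos : f v ≡ l2 → suc (twos f′) ≡ twos f
  lower-twos fv = subst (λ a → isTwo a + twos f′ ≡ twos f) fv (∑-[]≔ isTwo f v l1)

  raise-weight : f v ≡ l0 → weight f′ ≡ suc (weight f)
  raise-weight fv = subst (λ a → toℕ a + weight f′ ≡ 1 + weight f) fv (weight-[]≔ f v l1)

  raise-twos : f v ≡ l0 → twos f′ ≡ twos f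
  raise-twos fv = subst (λ a → isTwo a + twos f′ ≡ twos f) fv (∑-[]≔ isTwo f v l1)

Roman2Dominated : Graph n → Labeling n → Fin n → Set
Roman2Dominated G f v =
  (∃[ u ] (Adj G v u × f u ≡ l2)) ⊎
  (∃[ x ] ∃[ y ] (x ≢ y × Adj G v x × Adj G v y × f x ≡ l1 × f y ≡ l1))

isTR2DF? : (G : Graph n) (f : Labeling n) → Dec (IsTR2DF G f)
isTR2DF? G f =
  all? (λ v → f v ≟ l0 →-dec dominated? v) ×-dec
  all? (λ v → ¬? (f v ≟ l0) →-dec any? (λ u → T? (adj G v u) ×-dec ¬? (f u ≟ l0)))
  where
  dominated? : ∀ v → Dec (Roman2Dominated G f v)
  dominated? v =
    any? (λ u → T? (adj G v u) ×-dec f u ≟ l2) ⊎-dec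
    any? (λ x → any? (λ y → ¬? (x ≟ y) ×-dec T? (adj G v x) ×-dec T? (adj G v y) ×-dec
                             f x ≟ l1 ×-dec f y ≟ l1))

IsTR2DF-resp-≗ : f ≗ g → IsTR2DF G f → IsTR2DF G g
IsTR2DF-resp-≗ {f = f} {g} {G = G} f≗g (dominated , total) = dominated′ , total′
  where
  moved : ∀ {x a} → f x ≡ a → g x ≡ a
  moved {x} = trans (sym (f≗g x))

  dominated′ : ∀ z → g z ≡ l0 → Roman2Dominated G g z
  dominated′ z gz with dominated z (trans (f≗g z) gz)
  ... | inj₁ (u , z~u , fu) = inj₁ (u , z~u , moved fu)
  ... | inj₂ (x , y , x≢y , z~x , z~y , fx , fy) =
    inj₂ (x , y , x≢y , z~x , z~y , moved fx , moved fy)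

  total′ : ∀ z → g z ≢ l0 → ∃[ u ] (Adj G z u × g u ≢ l0)
  total′ z gz with total z (gz ∘ moved)
  ... | u , z~u , fu = u , z~u , fu ∘ trans (f≗g u)

γ-function-exists : (G : Graph n) → IsTR2DF G f → ∃[ f ] IsGammaTR2Function G f
γ-function-exists {n} G = ∃-minimal weight tr2df-within?
  where
  tr2df-within? : ∀ k → Dec (∃[ f ] (IsTR2DF G f × weight f ≤ k))
  tr2df-within? k =
    anyVector? n
      (λ f≗g (f-tr2 , f≤k) → IsTR2DF-resp-≗ {G = G} f≗g f-tr2 , subst (_≤ k) (weight-cong f≗g) f≤k)
      (λ f → isTR2DF? G f ×-dec weight f ≤? k)

ones-isTR2DF : (G : Graph n) → Nontrivial G → Connected G → IsTR2DF G (const l1)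
ones-isTR2DF G nontrivial connected =
  (λ _ ()) , λ v _ → let u , v~u = connected⇒neighbour G nontrivial connected v in u , v~u , λ ()

IsTR2DF-demote : (G : Graph n) → IsTR2DF G f → f v ≢ l0 → g v ≡ l1 →
  (∀ x → x ≢ v → g x ≡ f x ⊎ (Adj G x v × f x ≡ l0 × g x ≡ l1)) →
  (∀ z → Adj G v z → g z ≢ l0) →
  IsTR2DF G g
IsTR2DF-demote {f = f} {v} {g} G (dominated , total) fv≢0 gv≡1 change no-zero-neighbour =
  dominated′ , total′
  where
  gv≢0 : g v ≢ l0
  gv≢0 gv = contradiction (trans (sym gv≡1) gv) λ ()

  cases : ∀ x → x ≡ v ⊎ g x ≡ f x ⊎ (Adj G x v × f x ≡ l0 × g x ≡ l1)
  cases x with x ≟ v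
  ... | yes x≡v = inj₁ x≡v
  ... | no  x≢v = inj₂ (change x x≢v)

  ones-kept : ∀ x → f x ≡ l1 → g x ≡ l1
  ones-kept x fx with cases x
  ... | inj₁ refl                 = gv≡1
  ... | inj₂ (inj₁ gx≡fx)         = trans gx≡fx fx
  ... | inj₂ (inj₂ (_ , _ , gx)) = gx

  nonzero-kept : ∀ x → f x ≢ l0 → g x ≢ l0
  nonzero-kept x fx≢0 with cases x
  ... | inj₁ refl                   = gv≢0
  ... | inj₂ (inj₁ gx≡fx)           = fx≢0 ∘ trans (sym gx≡fx)
  ... | inj₂ (inj₂ (_ , fx≡0 , _)) = contradiction fx≡0 fx≢0

  zero-was-zero : ∀ x → g x ≡ l0 → f x ≡ l0
  zero-was-zero x gx with cases x
  ... | inj₁ refl                   = contradiction gx gv≢0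
  ... | inj₂ (inj₁ gx≡fx)           = trans (sym gx≡fx) gx
  ... | inj₂ (inj₂ (_ , fx≡0 , _)) = fx≡0

  twos-kept : ∀ x → x ≢ v → f x ≡ l2 → g x ≡ l2
  twos-kept x x≢v fx with change x x≢v
  ... | inj₁ gx≡fx          = trans gx≡fx fx
  ... | inj₂ (_ , fx≡0 , _) = contradiction (trans (sym fx) fx≡0) λ ()

  dominated′ : ∀ z → g z ≡ l0 → Roman2Dominated G g z
  dominated′ z gz with dominated z (zero-was-zero z gz)
  ... | inj₂ (x , y , x≢y , z~x , z~y , fx , fy) =
    inj₂ (x , y , x≢y , z~x , z~y , ones-kept x fx , ones-kept y fy)
  ... | inj₁ (u , z~u , fu) with u ≟ v
  ...   | yes refl = contradiction gz (no-zero-neighbour z (Adj-sym G z~u))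
  ...   | no  u≢v  = inj₁ (u , z~u , twos-kept u u≢v fu)

  total′ : ∀ z → g z ≢ l0 → ∃[ u ] (Adj G z u × g u ≢ l0)
  total′ z gz≢0 with f z ≟ l0
  ... | no fz≢0 = let u , z~u , fu≢0 = total z fz≢0 in u , z~u , nonzero-kept u fu≢0
  ... | yes fz with cases z
  ...   | inj₁ refl                 = contradiction fz fv≢0
  ...   | inj₂ (inj₁ gz≡fz)         = contradiction (trans gz≡fz fz) gz≢0
  ...   | inj₂ (inj₂ (z~v , _ , _)) = v , z~v , gv≢0

module _ (G : Graph n) {f : Labeling n} {v : Fin n} (f-tr2 : IsTR2DF G f) (fv : f v ≡ l2) where

  private
    f₁ : Labeling n
    f₁ = f [ v ]≔ l1

    fv≢0 : f v ≢ l0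
    fv≢0 fv≡0 = contradiction (trans (sym fv) fv≡0) λ ()

  demote-without-zero-neighbour : (∀ w → Adj G v w → f w ≢ l0) → IsTR2DF G f₁
  demote-without-zero-neighbour no-zero-neighbour =
    IsTR2DF-demote G f-tr2 fv≢0 (updateAt-updates v f)
      (λ x x≢v → inj₁ (updateAt-minimal x v f x≢v))
      (λ z v~z → no-zero-neighbour z v~z ∘
                 trans (sym (updateAt-minimal z v f (Adj-irrefl G v~z ∘ sym))))

  demote-with-zero-neighbour : MaxDegree≤ G 2 → Adj G v w → f w ≡ l0 → IsTR2DF G (f₁ [ w ]≔ l1)
  demote-with-zero-neighbour {w} Δ≤2 v~w fw =
    IsTR2DF-demote G f-tr2 fv≢0 (trans (updateAt-minimal v w f₁ v≢w) (updateAt-updates v f))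
      change no-zero-neighbour
    where
    f₂ : Labeling n
    f₂ = f₁ [ w ]≔ l1

    v≢w : v ≢ w
    v≢w = Adj-irrefl G v~w

    nonzero⇒≢w : ∀ {x} → f x ≢ l0 → x ≢ w
    nonzero⇒≢w fx≢0 refl = fx≢0 fw

    unchanged : ∀ {x} → x ≢ v → x ≢ w → f₂ x ≡ f x
    unchanged x≢v x≢w = trans (updateAt-minimal _ w f₁ x≢w) (updateAt-minimal _ v f x≢v)

    change : ∀ x → x ≢ v → f₂ x ≡ f x ⊎ (Adj G x v × f x ≡ l0 × f₂ x ≡ l1)
    change x x≢v with x ≟ w
    ... | yes refl = inj₂ (Adj-sym G v~w , fw , updateAt-updates w f₁)
    ... | no  x≢w  = inj₁ (unchanged x≢v x≢w)

    -- v also has a nonzero neighbour u ≠ w, so by Δ ≤ 2 it has no further neighbours.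
    no-zero-neighbour : ∀ z → Adj G v z → f₂ z ≢ l0
    no-zero-neighbour z v~z with proj₂ f-tr2 v fv≢0
    ... | u , v~u , fu≢0 with maxDegree≤2-neighbours G Δ≤2 v~u v~w (nonzero⇒≢w fu≢0) v~z
    ...   | inj₁ refl = fu≢0 ∘ trans (sym (unchanged (Adj-irrefl G v~u ∘ sym) (nonzero⇒≢w fu≢0)))
    ...   | inj₂ refl = λ f₂w → contradiction (trans (sym (updateAt-updates w f₁)) f₂w) λ ()

lower-two : (G : Graph n) → MaxDegree≤ G 2 → IsTR2DF G f → f v ≡ l2 →
  ∃[ g ] (IsTR2DF G g × weight g ≤ weight f × twos g < twos f)
lower-two {n} {f = f} {v} G Δ≤2 f-tr2 fv with any? (λ w → T? (adj G v w) ×-dec f w ≟ l0)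
... | no no-zero-neighbour =
  f [ v ]≔ l1 ,
  demote-without-zero-neighbour G f-tr2 fv (λ w v~w fw → no-zero-neighbour (w , v~w , fw)) ,
  <⇒≤ (≤-reflexive (lower-weight f v fv)) ,
  ≤-reflexive (lower-twos f v fv)
... | yes (w , v~w , fw) =
  f₁ [ w ]≔ l1 ,
  demote-with-zero-neighbour G f-tr2 fv Δ≤2 v~w fw ,
  ≤-reflexive (trans (raise-weight f₁ w f₁w) (lower-weight f v fv)) ,
  ≤-reflexive (trans (cong suc (raise-twos f₁ w f₁w)) (lower-twos f v fv))
  where
  f₁ : Labeling n
  f₁ = f [ v ]≔ l1

  f₁w : f₁ w ≡ l0
  f₁w = trans (updateAt-minimal w v f (Adj-irrefl G v~w ∘ sym)) fw

eliminate-twos : (G : Graph n) → MaxDegree≤ G 2 → IsTR2DF G f →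
  ∃[ g ] (IsTR2DF G g × weight g ≤ weight f × ∀ v → g v ≢ l2)
eliminate-twos {f = f} G Δ≤2 f-tr2 = go f-tr2 (<-wellFounded (twos f))
  where
  go : ∀ {f} → IsTR2DF G f → Acc _<_ (twos f) →
       ∃[ g ] (IsTR2DF G g × weight g ≤ weight f × ∀ v → g v ≢ l2)
  go {f} f-tr2 (acc smaller) with any? (λ v → f v ≟ l2)
  ... | no  no-two     = f , f-tr2 , ≤-refl , λ v fv → no-two (v , fv)
  ... | yes (v , fv) =
    let g , g-tr2 , g≤f , g<f      = lower-two G Δ≤2 f-tr2 fv
        h , h-tr2 , h≤g , h-no-two = go g-tr2 (smaller g<f)
    in h , h-tr2 , ≤-trans h≤g g≤f , h-no-two

mainTheorem6 : ∀ {n : ℕ} (G : Graph n) → Nontrivial G → Connected G → MaxDegree≤ G 2 →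
    ∃[ f ] (IsGammaTR2Function G f × (∀ (v : Fin n) → f v ≢ l2))
mainTheorem6 G nontrivial connected Δ≤2 =
  let f , f-tr2 , f-minimal     = γ-function-exists G (ones-isTR2DF G nontrivial connected)
      g , g-tr2 , g≤f , g-no-two = eliminate-twos G Δ≤2 f-tr2
  in g , (g-tr2 , λ h h-tr2 → ≤-trans g≤f (f-minimal h h-tr2)) , g-no-two
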